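{- Let $\mathcal{U}$ and $\mathcal{W}$ be weak universes. Then the relations $\geq_{\mathcal{U}}$ and $\geq_{\mathcal{W}}$ coincide on the set of all augmented forms.
   Context: Games are short partizan game forms under the misère convention (a player unable to move wins); $o_L(G)\in\{\mathscr{L},\mathscr{R}\}$ is the winner when Left moves first; outcome classes ordered $\mathscr{L}>\mathscr{N}>\mathscr{R}$, $\mathscr{L}>\mathscr{P}>\mathscr{R}$. Augmented forms (Siegel): game forms in which each subposition may carry a Left and/or Right tombstone (markers, not options); an augmented form is Left end-like if it has no Left options or carries a Left tombstone (Right end-like symmetrically); a player to move on a position end-like for them wins immediately; $G+H$ carries a Left tombstone iff both summands are Left end-like and at least one carries one. For a set of games $\mathcal{A}$, $G\geq_{\mathcal{A}}H$ iff $o(G+X)\geq o(H+X)$ for all $X\in\mathcal{A}$. A universe is a set $\mathcal{U}$ of games closed under sums, conjugates, options, and formation of $\{\mathscr{G}\mid\mathscr{H}\}$ for finite non-empty $\mathscr{G},\mathscr{H}\subseteq\mathcal{U}$. $G$ is Left $\mathcal{A}$-strong if $o_L(G+X)=\mathscr{L}$ for all Left ends $X\in\mathcal{A}$ (Right symmetrically). $\mathcal{A}$ is weak if for every augmented form $G$: $G$ is Left $\mathcal{A}$-strong iff $G$ is Left end-like, and $G$ is Right $\mathcal{A}$-strong iff $G$ is Right end-like. -}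

module Defs where

open import Data.Bool using (Bool; true; false; _∨_; _∧_; not)
open import Data.List using (List; []; _∷_; _++_)
open import Data.List.Relation.Unary.All using (All)
open import Data.List.Membership.Propositional using (_∈_)
open import Data.Product using (_×_; _,_)
open import Data.Sum using (_⊎_)
open import Relation.Binary.PropositionalEquality using (_≡_)
open import Function.Bundles using (_⇔_)

-- Augmented (short, partizan) forms.
-- node tL tR GL GR : a position whose Left options are GL, Right
-- options are GR, carrying a Left tombstone iff tL ≡ true and a Right
-- tombstone iff tR ≡ true.  Ordinary game forms are the augmented forms
-- with no tombstones anywhere (predicate Plain below).

data AForm : Set where
  node : (tL tR : Bool) (GL GR : List AForm) → AForm

leftTomb rightTomb : AForm → Bool
leftTomb  (node tL _ _ _) = tL
rightTomb (node _ tR _ _) = tR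

leftOpts rightOpts : AForm → List AForm
leftOpts  (node _ _ GL _) = GL
rightOpts (node _ _ _ GR) = GR

data Plain : AForm → Set where
  plain : {GL GR : List AForm} → All Plain GL → All Plain GR →
          Plain (node false false GL GR)

isNil : List AForm → Bool
isNil []      = true
isNil (_ ∷ _) = false

leftEndLikeᵇ rightEndLikeᵇ : AForm → Bool
leftEndLikeᵇ  (node tL _ GL _) = tL ∨ isNil GL
rightEndLikeᵇ (node _ tR _ GR) = tR ∨ isNil GR

LeftEndLike RightEndLike : AForm → Set
LeftEndLike  G = (leftTomb G ≡ true)  ⊎ (leftOpts G ≡ [])
RightEndLike G = (rightTomb G ≡ true) ⊎ (rightOpts G ≡ [])

LeftEnd RightEnd : AForm → Set
LeftEnd  G = leftOpts G ≡ []
RightEnd G = rightOpts G ≡ []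

mutual
  _+_ : AForm → AForm → AForm
  G@(node gl gr GL GR) + H@(node hl hr HL HR) =
    node (leftEndLikeᵇ G ∧ leftEndLikeᵇ H ∧ (gl ∨ hl))
         (rightEndLikeᵇ G ∧ rightEndLikeᵇ H ∧ (gr ∨ hr))
         (sumL GL H ++ sumR G HL)
         (sumL GR H ++ sumR G HR)

  sumL : List AForm → AForm → List AForm
  sumL []       H = []
  sumL (g ∷ gs) H = (g + H) ∷ sumL gs H

  sumR : AForm → List AForm → List AForm
  sumR G []       = []
  sumR G (h ∷ hs) = (G + h) ∷ sumR G hs

infixl 6 _+_

mutual
  conj : AForm → AForm
  conj (node tL tR GL GR) = node tR tL (conjs GR) (conjs GL)

  conjs : List AForm → List AForm
  conjs []       = []
  conjs (g ∷ gs) = conj g ∷ conjs gs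

-- Misère play with tombstones.
-- leftFirstWins G  = true  iff  o_L(G) = 𝓛  (Left, moving first, wins)
-- rightFirstWins G = true  iff  o_R(G) = 𝓡  (Right, moving first, wins)
-- A player to move on a position end-like for them wins immediately;
-- otherwise they win iff some option of theirs is a win for them with
-- the opponent to move.

mutual
  leftFirstWins : AForm → Bool
  leftFirstWins (node true  _ GL _) = true
  leftFirstWins (node false _ [] _) = true
  leftFirstWins (node false _ (g ∷ gs) _) = anyLeftGood (g ∷ gs)

  anyLeftGood : List AForm → Bool
  anyLeftGood []       = false
  anyLeftGood (g ∷ gs) = not (rightFirstWins g) ∨ anyLeftGood gs

  rightFirstWins : AForm → Bool
  rightFirstWins (node _ true  _ GR) = true
  rightFirstWins (node _ false _ []) = true
  rightFirstWins (node _ false _ (g ∷ gs)) = anyRightGood (g ∷ gs)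

  anyRightGood : List AForm → Bool
  anyRightGood []       = false
  anyRightGood (g ∷ gs) = not (leftFirstWins g) ∨ anyRightGood gs

data Player : Set where
  𝓛 𝓡 : Player

oL oR : AForm → Player
oL G with leftFirstWins G
... | true  = 𝓛
... | false = 𝓡
oR G with rightFirstWins G
... | true  = 𝓡
... | false = 𝓛

data Outcome : Set where
  𝓛ₒ 𝓝ₒ 𝓟ₒ 𝓡ₒ : Outcome

outcomeOf : Player → Player → Outcome
outcomeOf 𝓛 𝓛 = 𝓛ₒ
outcomeOf 𝓛 𝓡 = 𝓝ₒ
outcomeOf 𝓡 𝓛 = 𝓟ₒ
outcomeOf 𝓡 𝓡 = 𝓡ₒ

o : AForm → Outcome
o G = outcomeOf (oL G) (oR G)

data _≥ₒ_ : Outcome → Outcome → Set where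
  ≥ₒ-refl : ∀ {a} → a ≥ₒ a
  𝓛≥𝓝 : 𝓛ₒ ≥ₒ 𝓝ₒ
  𝓛≥𝓟 : 𝓛ₒ ≥ₒ 𝓟ₒ
  𝓛≥𝓡 : 𝓛ₒ ≥ₒ 𝓡ₒ
  𝓝≥𝓡 : 𝓝ₒ ≥ₒ 𝓡ₒ
  𝓟≥𝓡 : 𝓟ₒ ≥ₒ 𝓡ₒ

GameSet : Set₁
GameSet = AForm → Set

_≥[_]_ : AForm → GameSet → AForm → Set
G ≥[ A ] H = ∀ X → A X → o (G + X) ≥ₒ o (H + X)

record Universe (U : GameSet) : Set where
  field
    games    : ∀ {G} → U G → Plain G
    sums     : ∀ {G H} → U G → U H → U (G + H)
    conjugates : ∀ {G} → U G → U (conj G)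
    leftOpt  : ∀ {G GL} → U G → GL ∈ leftOpts G → U GL
    rightOpt : ∀ {G GR} → U G → GR ∈ rightOpts G → U GR
    form     : ∀ (g : AForm) (gs : List AForm) (h : AForm) (hs : List AForm) →
               All U (g ∷ gs) → All U (h ∷ hs) →
               U (node false false (g ∷ gs) (h ∷ hs))

LeftStrong RightStrong : GameSet → AForm → Set
LeftStrong  A G = ∀ X → A X → LeftEnd X  → oL (G + X) ≡ 𝓛
RightStrong A G = ∀ X → A X → RightEnd X → oR (G + X) ≡ 𝓡

Weak : GameSet → Set
Weak A = ∀ (G : AForm) →
  (LeftStrong A G ⇔ LeftEndLike G) × (RightStrong A G ⇔ RightEndLike G)

-- For a weak universe U, G ≥_U H is equivalent to a local comparison test: the provisos
-- (H Left end-like ⇒ G Left end-like, G Right end-like ⇒ H Right end-like) and maintenance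
-- (every H^L is answered by some G^L ≥ H^L or some H^LR ≤ G; every G^R by some H^R ≤ G^R
-- or some G^RL ≥ H).  The test implies G ≥_W H for any option-closed W, by induction on the
-- game X added to both sides.  Conversely, weakness says {K |} is not Left U-strong, so for every K
-- some X ∈ U lets Right win K + X moving first (and dually); combining such games with
-- distinguishers of smaller pairs inside U produces a game refuting G ≥_U H whenever
-- maintenance fails.  As the test only mentions the order on pairs of smaller total size,
-- induction gives ≥_U ⊆ ≥_W for every weak universe U and option-closed W.

module Submission where

open import Defs
open import Data.Bool using (true; false; _∧_)
open import Data.Bool.Properties using (_≟_; ∧-zeroʳ; ∨-zeroʳ; ∧-conicalˡ; ∧-conicalʳ; ¬-not; not-¬)
open import Data.List using (List; []; _∷_; _++_; map)
open import Data.List.Membership.Propositional using (_∈_; lose)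
open import Data.List.Relation.Unary.All as All using (All; []; _∷_)
open import Data.List.Relation.Unary.All.Properties as All using (¬Any⇒All¬)
open import Data.List.Relation.Unary.Any as Any using (Any; here; there)
open import Data.List.Relation.Unary.Any.Properties as Any using ()
open import Data.Nat using (ℕ; suc; _<_; _≤_; s≤s) renaming (_+_ to _+ℕ_)
open import Data.Nat.Induction using (<-rec)
open import Data.Nat.Properties using (m≤m+n; m≤n+m; ≤-trans; <-trans; +-mono-<; +-monoˡ-<; +-monoʳ-<)
open import Data.Product using (∃; _×_; _,_; proj₁; proj₂)
open import Data.Sum as Sum using (_⊎_; inj₁; inj₂; [_,_]′)
open import Effect.Monad using (RawMonad)
open import Function using (_∘_)
open import Level using (0ℓ)
open import Function.Bundles using (_⇔_; mk⇔; Equivalence)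
open import Relation.Binary.PropositionalEquality using (_≡_; refl; sym; trans; cong; cong₂; subst)
open import Relation.Nullary using (¬_)
open import Relation.Nullary.Decidable using (decidable-stable)
open import Relation.Nullary.Negation using (¬¬-Monad; ¬¬-map; Stable; contradiction)

≡true-stable : ∀ {b} → Stable (b ≡ true)
≡true-stable {b} = decidable-stable (b ≟ true)

contraposeᵇ : ∀ {a b} → (a ≡ true → b ≡ true) → b ≡ false → a ≡ false
contraposeᵇ f b≡false = ¬-not λ a≡true → not-¬ (f a≡true) b≡false

any-apply : {A : Set} {P Q : A → Set} {xs : List A} → All (λ x → P x → Q x) xs → Any P xs → Any Q xs
any-apply (f ∷ _)  (here p)  = here (f p)
any-apply (_ ∷ fs) (there p) = there (any-apply fs p)

collectWitnesses : {A B : Set} {Q : B → Set} {R : A → B → Set} {xs : List A} →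
  All (λ x → ∃ λ y → Q y × R x y) xs → ∃ λ ys → All Q ys × All (λ x → Any (R x) ys) xs
collectWitnesses [] = [] , [] , []
collectWitnesses ((y , q , r) ∷ rest) =
  let (ys , qs , rs) = collectWitnesses rest in y ∷ ys , q ∷ qs , here r ∷ All.map there rs

sequence¬¬ : {A : Set} {P : A → Set} {xs : List A} → All (λ x → ¬ ¬ P x) xs → ¬ ¬ All P xs
sequence¬¬ = All.sequenceM _ ¬¬-Monad

module _ {P : AForm → Set} (step : ∀ X → All P (leftOpts X) → All P (rightOpts X) → P X) where

  mutual
    option-induction : ∀ X → P X
    option-induction (node _ _ XL XR) = step _ (option-inductions XL) (option-inductions XR)

    option-inductions : ∀ Xs → All P Xs
    option-inductions []       = []
    option-inductions (X ∷ Xs) = option-induction X ∷ option-inductions Xs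

mutual
  size : AForm → ℕ
  size (node _ _ GL GR) = suc (sizes GL +ℕ sizes GR)

  sizes : List AForm → ℕ
  sizes []       = 0
  sizes (g ∷ gs) = size g +ℕ sizes gs

size≤sizes : ∀ gs → All (λ g → size g ≤ sizes gs) gs
size≤sizes []       = []
size≤sizes (g ∷ gs) =
  m≤m+n (size g) (sizes gs) ∷ All.map (λ le → ≤-trans le (m≤n+m _ (size g))) (size≤sizes gs)

leftOpts-smaller : ∀ G → All (λ G' → size G' < size G) (leftOpts G)
leftOpts-smaller (node _ _ GL GR) = All.map (λ le → s≤s (≤-trans le (m≤m+n _ (sizes GR)))) (size≤sizes GL)

rightOpts-smaller : ∀ G → All (λ G' → size G' < size G) (rightOpts G)
rightOpts-smaller (node _ _ GL GR) = All.map (λ le → s≤s (≤-trans le (m≤n+m _ (sizes GL)))) (size≤sizes GR)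

size-induction : {P : AForm → AForm → Set} →
  (∀ {G H} → (∀ A B → size A +ℕ size B < size G +ℕ size H → P A B) → P G H) → ∀ G H → P G H
size-induction {P} step G H = <-rec Below below (size G +ℕ size H) {G} {H} refl
  where
  Below : ℕ → Set
  Below n = ∀ {G H} → size G +ℕ size H ≡ n → P G H
  below : ∀ n → (∀ {m} → m < n → Below m) → Below n
  below _ smaller refl = step λ _ _ lt → smaller lt refl

LeftWinsFirst LeftLosesFirst RightWinsFirst RightLosesFirst : AForm → Set
LeftWinsFirst   K = leftFirstWins K ≡ true
LeftLosesFirst  K = leftFirstWins K ≡ false
RightWinsFirst  K = rightFirstWins K ≡ true
RightLosesFirst K = rightFirstWins K ≡ false

infix 4 _≥ₚ_
data _≥ₚ_ : Player → Player → Set where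
  𝓛≥  : ∀ {p} → 𝓛 ≥ₚ p
  𝓡≥𝓡 : 𝓡 ≥ₚ 𝓡

outcomeOf-mono : ∀ {a b c d} → a ≥ₚ c → b ≥ₚ d → outcomeOf a b ≥ₒ outcomeOf c d
outcomeOf-mono {c = 𝓛} {d = 𝓛} 𝓛≥ 𝓛≥ = ≥ₒ-refl
outcomeOf-mono {c = 𝓛} {d = 𝓡} 𝓛≥ 𝓛≥ = 𝓛≥𝓝
outcomeOf-mono {c = 𝓡} {d = 𝓛} 𝓛≥ 𝓛≥ = 𝓛≥𝓟
outcomeOf-mono {c = 𝓡} {d = 𝓡} 𝓛≥ 𝓛≥ = 𝓛≥𝓡
outcomeOf-mono {c = 𝓛}         𝓛≥ 𝓡≥𝓡 = ≥ₒ-refl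
outcomeOf-mono {c = 𝓡}         𝓛≥ 𝓡≥𝓡 = 𝓝≥𝓡
outcomeOf-mono         {d = 𝓛} 𝓡≥𝓡 𝓛≥ = ≥ₒ-refl
outcomeOf-mono         {d = 𝓡} 𝓡≥𝓡 𝓛≥ = 𝓟≥𝓡
outcomeOf-mono                 𝓡≥𝓡 𝓡≥𝓡 = ≥ₒ-refl

outcomeOf-cancel : ∀ a b c d → outcomeOf a b ≥ₒ outcomeOf c d → a ≥ₚ c × b ≥ₚ d
outcomeOf-cancel 𝓛 𝓛 _ _ _ = 𝓛≥ , 𝓛≥
outcomeOf-cancel 𝓛 𝓡 _ 𝓡 _ = 𝓛≥ , 𝓡≥𝓡
outcomeOf-cancel 𝓛 𝓡 𝓛 𝓛 ()
outcomeOf-cancel 𝓛 𝓡 𝓡 𝓛 ()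
outcomeOf-cancel 𝓡 𝓛 𝓡 _ _ = 𝓡≥𝓡 , 𝓛≥
outcomeOf-cancel 𝓡 𝓛 𝓛 𝓛 ()
outcomeOf-cancel 𝓡 𝓛 𝓛 𝓡 ()
outcomeOf-cancel 𝓡 𝓡 𝓡 𝓡 _ = 𝓡≥𝓡 , 𝓡≥𝓡
outcomeOf-cancel 𝓡 𝓡 𝓛 𝓛 ()
outcomeOf-cancel 𝓡 𝓡 𝓛 𝓡 ()
outcomeOf-cancel 𝓡 𝓡 𝓡 𝓛 ()

oL-≥ₚ⇔ : ∀ K M → oL K ≥ₚ oL M ⇔ (LeftWinsFirst M → LeftWinsFirst K)
oL-≥ₚ⇔ K M with leftFirstWins K | leftFirstWins M
... | true  | _     = mk⇔ (λ _ _ → refl) (λ _ → 𝓛≥)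
... | false | true  = mk⇔ (λ ()) (λ f → contradiction (f refl) λ ())
... | false | false = mk⇔ (λ _ ()) (λ _ → 𝓡≥𝓡)

oR-≥ₚ⇔ : ∀ K M → oR K ≥ₚ oR M ⇔ (RightWinsFirst K → RightWinsFirst M)
oR-≥ₚ⇔ K M with rightFirstWins K | rightFirstWins M
... | false | _     = mk⇔ (λ _ ()) (λ _ → 𝓛≥)
... | true  | true  = mk⇔ (λ _ _ → refl) (λ _ → 𝓡≥𝓡)
... | true  | false = mk⇔ (λ ()) (λ f → contradiction (f refl) λ ())

oL≡𝓛 : ∀ K → LeftWinsFirst K → oL K ≡ 𝓛
oL≡𝓛 K w with leftFirstWins K
oL≡𝓛 K refl | true = refl

oR≡𝓡 : ∀ K → RightWinsFirst K → oR K ≡ 𝓡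
oR≡𝓡 K w with rightFirstWins K
oR≡𝓡 K refl | true = refl

infix 4 _≽_
record _≽_ (K M : AForm) : Set where
  field
    leftFirst  : LeftWinsFirst M → LeftWinsFirst K
    rightFirst : RightWinsFirst K → RightWinsFirst M

open _≽_

≥ₒ⇔≽ : ∀ {K M} → o K ≥ₒ o M ⇔ K ≽ M
≥ₒ⇔≽ {K} {M} = mk⇔ to from
  where
  to : o K ≥ₒ o M → K ≽ M
  to ge with outcomeOf-cancel (oL K) (oR K) (oL M) (oR M) ge
  ... | l , r = record { leftFirst  = Equivalence.to (oL-≥ₚ⇔ K M) l
                       ; rightFirst = Equivalence.to (oR-≥ₚ⇔ K M) r }
  from : K ≽ M → o K ≥ₒ o M
  from k = outcomeOf-mono (Equivalence.from (oL-≥ₚ⇔ K M) (leftFirst k))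
                          (Equivalence.from (oR-≥ₚ⇔ K M) (rightFirst k))

≥-≽ : ∀ {A : GameSet} G H → G ≥[ A ] H → ∀ {X} → A X → G + X ≽ H + X
≥-≽ _ _ ge {X} x∈A = Equivalence.to ≥ₒ⇔≽ (ge X x∈A)

≽-leftLoses : ∀ {K M} → K ≽ M → LeftLosesFirst K → LeftLosesFirst M
≽-leftLoses k = contraposeᵇ (leftFirst k)

≽-rightLoses : ∀ {K M} → K ≽ M → RightLosesFirst M → RightLosesFirst K
≽-rightLoses k = contraposeᵇ (rightFirst k)

anyLeftGood-sound : ∀ gs → anyLeftGood gs ≡ true → Any RightLosesFirst gs
anyLeftGood-sound (g ∷ gs) e with rightFirstWins g in eq
... | true  = there (anyLeftGood-sound gs e)
... | false = here eq

anyLeftGood-complete : ∀ {gs} → Any RightLosesFirst gs → anyLeftGood gs ≡ true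
anyLeftGood-complete (here l) rewrite l = refl
anyLeftGood-complete {g ∷ _} (there a) rewrite anyLeftGood-complete a = ∨-zeroʳ _

anyRightGood-sound : ∀ gs → anyRightGood gs ≡ true → Any LeftLosesFirst gs
anyRightGood-sound (g ∷ gs) e with leftFirstWins g in eq
... | true  = there (anyRightGood-sound gs e)
... | false = here eq

anyRightGood-complete : ∀ {gs} → Any LeftLosesFirst gs → anyRightGood gs ≡ true
anyRightGood-complete (here l) rewrite l = refl
anyRightGood-complete {g ∷ _} (there a) rewrite anyRightGood-complete a = ∨-zeroʳ _

leftWinsFirst-endLike : ∀ K → leftEndLikeᵇ K ≡ true → LeftWinsFirst K
leftWinsFirst-endLike (node true  _ _ _)       _ = refl
leftWinsFirst-endLike (node false _ [] _)      _ = refl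
leftWinsFirst-endLike (node false _ (_ ∷ _) _) ()

leftWinsFirst-move : ∀ K → Any RightLosesFirst (leftOpts K) → LeftWinsFirst K
leftWinsFirst-move (node true  _ _ _)       _ = refl
leftWinsFirst-move (node false _ (_ ∷ _) _) a = anyLeftGood-complete a

leftWinsFirst-cases : ∀ K → LeftWinsFirst K → leftEndLikeᵇ K ≡ true ⊎ Any RightLosesFirst (leftOpts K)
leftWinsFirst-cases (node true  _ _ _)        _ = inj₁ refl
leftWinsFirst-cases (node false _ [] _)       _ = inj₁ refl
leftWinsFirst-cases (node false _ (g ∷ gs) _) e = inj₂ (anyLeftGood-sound (g ∷ gs) e)

leftLosesFirst : ∀ K → leftEndLikeᵇ K ≡ false → All RightWinsFirst (leftOpts K) → LeftLosesFirst K
leftLosesFirst K notEnd replies =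
  ¬-not λ w → [ (λ end → not-¬ end notEnd) , refuted ]′ (leftWinsFirst-cases K w)
  where
  refuted : ¬ Any RightLosesFirst (leftOpts K)
  refuted a = let (r , l) = All.lookupAny replies a in not-¬ r l

leftLosesFirst-replies : ∀ K → LeftLosesFirst K → All RightWinsFirst (leftOpts K)
leftLosesFirst-replies K l =
  All.tabulate λ K'∈ → ¬-not λ l' → not-¬ (leftWinsFirst-move K (lose K'∈ l')) l

rightWinsFirst-endLike : ∀ K → rightEndLikeᵇ K ≡ true → RightWinsFirst K
rightWinsFirst-endLike (node _ true  _ _)       _ = refl
rightWinsFirst-endLike (node _ false _ [])      _ = refl
rightWinsFirst-endLike (node _ false _ (_ ∷ _)) ()

rightWinsFirst-move : ∀ K → Any LeftLosesFirst (rightOpts K) → RightWinsFirst K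
rightWinsFirst-move (node _ true  _ _)       _ = refl
rightWinsFirst-move (node _ false _ (_ ∷ _)) a = anyRightGood-complete a

rightWinsFirst-cases : ∀ K → RightWinsFirst K → rightEndLikeᵇ K ≡ true ⊎ Any LeftLosesFirst (rightOpts K)
rightWinsFirst-cases (node _ true  _ _)        _ = inj₁ refl
rightWinsFirst-cases (node _ false _ [])       _ = inj₁ refl
rightWinsFirst-cases (node _ false _ (g ∷ gs)) e = inj₂ (anyRightGood-sound (g ∷ gs) e)

rightLosesFirst : ∀ K → rightEndLikeᵇ K ≡ false → All LeftWinsFirst (rightOpts K) → RightLosesFirst K
rightLosesFirst K notEnd replies =
  ¬-not λ w → [ (λ end → not-¬ end notEnd) , refuted ]′ (rightWinsFirst-cases K w)
  where
  refuted : ¬ Any LeftLosesFirst (rightOpts K)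
  refuted a = let (r , l) = All.lookupAny replies a in not-¬ r l

rightLosesFirst-replies : ∀ K → RightLosesFirst K → All LeftWinsFirst (rightOpts K)
rightLosesFirst-replies K l =
  All.tabulate λ K'∈ → ¬-not λ l' → not-¬ (rightWinsFirst-move K (lose K'∈ l')) l

leftEndLike⇒ᵇ : ∀ G → LeftEndLike G → leftEndLikeᵇ G ≡ true
leftEndLike⇒ᵇ (node _  _ _ _) (inj₁ refl) = refl
leftEndLike⇒ᵇ (node tL _ _ _) (inj₂ refl) = ∨-zeroʳ tL

rightEndLike⇒ᵇ : ∀ G → RightEndLike G → rightEndLikeᵇ G ≡ true
rightEndLike⇒ᵇ (node _ _  _ _) (inj₁ refl) = refl
rightEndLike⇒ᵇ (node _ tR _ _) (inj₂ refl) = ∨-zeroʳ tR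

leftEndLikeᵇ-+ : ∀ G X → leftEndLikeᵇ (G + X) ≡ leftEndLikeᵇ G ∧ leftEndLikeᵇ X
leftEndLikeᵇ-+ (node true  _ _ _)       (node true  _ _ _)       = refl
leftEndLikeᵇ-+ (node true  _ _ _)       (node false _ [] _)      = refl
leftEndLikeᵇ-+ (node true  _ [] _)      (node false _ (_ ∷ _) _) = refl
leftEndLikeᵇ-+ (node true  _ (_ ∷ _) _) (node false _ (_ ∷ _) _) = refl
leftEndLikeᵇ-+ (node false _ [] _)      (node true  _ _ _)       = refl
leftEndLikeᵇ-+ (node false _ (_ ∷ _) _) (node true  _ _ _)       = refl
leftEndLikeᵇ-+ (node false _ [] _)      (node false _ [] _)      = refl
leftEndLikeᵇ-+ (node false _ [] _)      (node false _ (_ ∷ _) _) = refl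
leftEndLikeᵇ-+ (node false _ (_ ∷ _) _) (node false _ _ _)       = refl

rightEndLikeᵇ-+ : ∀ G X → rightEndLikeᵇ (G + X) ≡ rightEndLikeᵇ G ∧ rightEndLikeᵇ X
rightEndLikeᵇ-+ (node _ true  _ _)       (node _ true  _ _)       = refl
rightEndLikeᵇ-+ (node _ true  _ _)       (node _ false _ [])      = refl
rightEndLikeᵇ-+ (node _ true  _ [])      (node _ false _ (_ ∷ _)) = refl
rightEndLikeᵇ-+ (node _ true  _ (_ ∷ _)) (node _ false _ (_ ∷ _)) = refl
rightEndLikeᵇ-+ (node _ false _ [])      (node _ true  _ _)       = refl
rightEndLikeᵇ-+ (node _ false _ (_ ∷ _)) (node _ true  _ _)       = refl
rightEndLikeᵇ-+ (node _ false _ [])      (node _ false _ [])      = refl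
rightEndLikeᵇ-+ (node _ false _ [])      (node _ false _ (_ ∷ _)) = refl
rightEndLikeᵇ-+ (node _ false _ (_ ∷ _)) (node _ false _ _)       = refl

leftEndLikeᵇ-+-endLike : ∀ G X → leftEndLikeᵇ G ≡ true → leftEndLikeᵇ X ≡ true →
  leftEndLikeᵇ (G + X) ≡ true
leftEndLikeᵇ-+-endLike G X g x = trans (leftEndLikeᵇ-+ G X) (cong₂ _∧_ g x)

rightEndLikeᵇ-+-endLike : ∀ G X → rightEndLikeᵇ G ≡ true → rightEndLikeᵇ X ≡ true →
  rightEndLikeᵇ (G + X) ≡ true
rightEndLikeᵇ-+-endLike G X g x = trans (rightEndLikeᵇ-+ G X) (cong₂ _∧_ g x)

sumL≡map : ∀ gs H → sumL gs H ≡ map (_+ H) gs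
sumL≡map []       H = refl
sumL≡map (g ∷ gs) H = cong (g + H ∷_) (sumL≡map gs H)

sumR≡map : ∀ G hs → sumR G hs ≡ map (G +_) hs
sumR≡map G []       = refl
sumR≡map G (h ∷ hs) = cong (G + h ∷_) (sumR≡map G hs)

leftOpts-+ : ∀ G X → leftOpts (G + X) ≡ map (_+ X) (leftOpts G) ++ map (G +_) (leftOpts X)
leftOpts-+ (node _ _ GL _) (node _ _ XL _) = cong₂ _++_ (sumL≡map GL _) (sumR≡map _ XL)

rightOpts-+ : ∀ G X → rightOpts (G + X) ≡ map (_+ X) (rightOpts G) ++ map (G +_) (rightOpts X)
rightOpts-+ (node _ _ _ GR) (node _ _ _ XR) = cong₂ _++_ (sumL≡map GR _) (sumR≡map _ XR)

module SumOptions (opts : AForm → List AForm)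
                  (opts-+ : ∀ G X → opts (G + X) ≡ map (_+ X) (opts G) ++ map (G +_) (opts X))
                  {P : AForm → Set} where

  Any⁺ˡ : ∀ G X → Any (λ G' → P (G' + X)) (opts G) → Any P (opts (G + X))
  Any⁺ˡ G X a = subst (Any P) (sym (opts-+ G X)) (Any.++⁺ˡ (Any.map⁺ a))

  Any⁺ʳ : ∀ G X → Any (λ X' → P (G + X')) (opts X) → Any P (opts (G + X))
  Any⁺ʳ G X a = subst (Any P) (sym (opts-+ G X)) (Any.++⁺ʳ _ (Any.map⁺ a))

  Any⁻ : ∀ G X → Any P (opts (G + X)) →
    Any (λ G' → P (G' + X)) (opts G) ⊎ Any (λ X' → P (G + X')) (opts X)
  Any⁻ G X a = Sum.map Any.map⁻ Any.map⁻ (Any.++⁻ _ (subst (Any P) (opts-+ G X) a))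

  All⁺ : ∀ G X → All (λ G' → P (G' + X)) (opts G) → All (λ X' → P (G + X')) (opts X) →
    All P (opts (G + X))
  All⁺ G X l r = subst (All P) (sym (opts-+ G X)) (All.++⁺ (All.map⁺ l) (All.map⁺ r))

  All⁻ˡ : ∀ G X → All P (opts (G + X)) → All (λ G' → P (G' + X)) (opts G)
  All⁻ˡ G X a = All.map⁻ (All.++⁻ˡ _ (subst (All P) (opts-+ G X) a))

module +ᴸ = SumOptions leftOpts leftOpts-+
module +ᴿ = SumOptions rightOpts rightOpts-+

leftLosesFirst-+ : ∀ A {l ls Rs} → All (λ L → RightWinsFirst (A + L)) (l ∷ ls) →
  All (λ A' → Any (λ R → LeftLosesFirst (A' + R)) Rs) (leftOpts A) →
  LeftLosesFirst (A + node false false (l ∷ ls) Rs)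
leftLosesFirst-+ A {l} {ls} {Rs} losingMoves answers =
  leftLosesFirst (A + X) notEndLike
    (+ᴸ.All⁺ A X (All.map (λ {A'} a → rightWinsFirst-move (A' + X) (+ᴿ.Any⁺ʳ A' X a)) answers) losingMoves)
  where
  X : AForm
  X = node false false (l ∷ ls) Rs
  notEndLike : leftEndLikeᵇ (A + X) ≡ false
  notEndLike = trans (leftEndLikeᵇ-+ A X) (∧-zeroʳ _)

rightLosesFirst-+ : ∀ B {Ls r rs} → All (λ R → LeftWinsFirst (B + R)) (r ∷ rs) →
  All (λ B' → Any (λ L → RightLosesFirst (B' + L)) Ls) (rightOpts B) →
  RightLosesFirst (B + node false false Ls (r ∷ rs))
rightLosesFirst-+ B {Ls} {r} {rs} losingMoves answers =
  rightLosesFirst (B + X) notEndLike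
    (+ᴿ.All⁺ B X (All.map (λ {B'} a → leftWinsFirst-move (B' + X) (+ᴸ.Any⁺ʳ B' X a)) answers) losingMoves)
  where
  X : AForm
  X = node false false Ls (r ∷ rs)
  notEndLike : rightEndLikeᵇ (B + X) ≡ false
  notEndLike = trans (rightEndLikeᵇ-+ B X) (∧-zeroʳ _)

-- The comparison test

LeftMaintenance : (AForm → AForm → Set) → AForm → AForm → Set
LeftMaintenance R G H' = Any (λ G' → R G' H') (leftOpts G) ⊎ Any (R G) (rightOpts H')

RightMaintenance : (AForm → AForm → Set) → AForm → AForm → Set
RightMaintenance R G' H = Any (R G') (rightOpts H) ⊎ Any (λ G'' → R G'' H) (leftOpts G')

-- ≥_U quantifies over all of U, so maintenance is only obtained up to double negation; it is
-- only ever used to prove Boolean equations, which are ¬¬-stable.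
record ComparisonTest (R : AForm → AForm → Set) (G H : AForm) : Set where
  field
    proviso-left      : leftEndLikeᵇ H ≡ true → leftEndLikeᵇ G ≡ true
    proviso-right     : rightEndLikeᵇ G ≡ true → rightEndLikeᵇ H ≡ true
    maintenance-left  : All (λ H' → ¬ ¬ LeftMaintenance R G H') (leftOpts H)
    maintenance-right : All (λ G' → ¬ ¬ RightMaintenance R G' H) (rightOpts G)

test-map : ∀ {R R' G H} → (∀ A B → size A +ℕ size B < size G +ℕ size H → R A B → R' A B) →
  ComparisonTest R G H → ComparisonTest R' G H
test-map {R} {R'} {G} {H} f t = record
  { proviso-left      = proviso-left
  ; proviso-right     = proviso-right
  ; maintenance-left  = All.zipWith (λ (H'< , m) → ¬¬-map (left H'<) m) (leftOpts-smaller H , maintenance-left)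
  ; maintenance-right = All.zipWith (λ (G'< , m) → ¬¬-map (right G'<) m) (rightOpts-smaller G , maintenance-right)
  }
  where
  open ComparisonTest t
  left : ∀ {H'} → size H' < size H → LeftMaintenance R G H' → LeftMaintenance R' G H'
  left {H'} H'< = Sum.map
    (any-apply (All.map (λ {G'} G'< → f G' H' (+-mono-< G'< H'<)) (leftOpts-smaller G)))
    (any-apply (All.map (λ {H''} H''< → f G H'' (+-monoʳ-< (size G) (<-trans H''< H'<))) (rightOpts-smaller H')))
  right : ∀ {G'} → size G' < size G → RightMaintenance R G' H → RightMaintenance R' G' H
  right {G'} G'< = Sum.map
    (any-apply (All.map (λ {H'} H'< → f G' H' (+-mono-< G'< H'<)) (rightOpts-smaller H)))
    (any-apply (All.map (λ {G''} G''< → f G'' H (+-monoˡ-< (size H) (<-trans G''< G'<))) (leftOpts-smaller G')))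

-- Sufficiency

OptionClosed : GameSet → Set
OptionClosed A = ∀ {X} → A X → All A (leftOpts X) × All A (rightOpts X)

universe-optionClosed : ∀ {U} → Universe U → OptionClosed U
universe-optionClosed isU x∈U =
  All.tabulate (Universe.leftOpt isU x∈U) , All.tabulate (Universe.rightOpt isU x∈U)

module _ {W : GameSet} {G H : AForm} (test : ComparisonTest _≥[ W ]_ G H) where
  open ComparisonTest test

  private
    leftAnswer : ∀ {X} H' → W X → RightLosesFirst (H' + X) → LeftMaintenance _≥[ W ]_ G H' →
      LeftWinsFirst (G + X)
    leftAnswer {X} H' x∈W l (inj₁ viaG) =
      leftWinsFirst-move (G + X)
        (+ᴸ.Any⁺ˡ G X (Any.map (λ {G'} ge → ≽-rightLoses (≥-≽ G' H' ge x∈W) l) viaG))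
    leftAnswer {X} H' x∈W l (inj₂ viaH'') =
      All.lookupWith (λ {H''} w ge → leftFirst (≥-≽ G H'' ge x∈W) w)
        (+ᴿ.All⁻ˡ H' X (rightLosesFirst-replies (H' + X) l)) viaH''

    rightAnswer : ∀ {X} G' → W X → LeftLosesFirst (G' + X) → RightMaintenance _≥[ W ]_ G' H →
      RightWinsFirst (H + X)
    rightAnswer {X} G' x∈W l (inj₁ viaH) =
      rightWinsFirst-move (H + X)
        (+ᴿ.Any⁺ˡ H X (Any.map (λ {H'} ge → ≽-leftLoses (≥-≽ G' H' ge x∈W) l) viaH))
    rightAnswer {X} G' x∈W l (inj₂ viaG'') =
      All.lookupWith (λ {G''} w ge → rightFirst (≥-≽ G'' H ge x∈W) w)
        (+ᴸ.All⁻ˡ G' X (leftLosesFirst-replies (G' + X) l)) viaG''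

    ≽-step : ∀ {X} → W X →
      All (λ X' → G + X' ≽ H + X') (leftOpts X) → All (λ X' → G + X' ≽ H + X') (rightOpts X) →
      G + X ≽ H + X
    ≽-step {X} x∈W ihL ihR = record { leftFirst = leftFirst' ; rightFirst = rightFirst' }
      where
      leftFirst' : LeftWinsFirst (H + X) → LeftWinsFirst (G + X)
      leftFirst' w with leftWinsFirst-cases (H + X) w
      ... | inj₁ end =
        let endHX = trans (sym (leftEndLikeᵇ-+ H X)) end
        in leftWinsFirst-endLike (G + X)
             (leftEndLikeᵇ-+-endLike G X (proviso-left (∧-conicalˡ _ _ endHX)) (∧-conicalʳ _ _ endHX))
      ... | inj₂ a with +ᴸ.Any⁻ H X a
      ...   | inj₁ viaH =
        All.lookupWith (λ {H'} m l → ≡true-stable (¬¬-map (leftAnswer H' x∈W l) m)) maintenance-left viaH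
      ...   | inj₂ viaX =
        leftWinsFirst-move (G + X) (+ᴸ.Any⁺ʳ G X (any-apply (All.map ≽-rightLoses ihL) viaX))
      rightFirst' : RightWinsFirst (G + X) → RightWinsFirst (H + X)
      rightFirst' w with rightWinsFirst-cases (G + X) w
      ... | inj₁ end =
        let endGX = trans (sym (rightEndLikeᵇ-+ G X)) end
        in rightWinsFirst-endLike (H + X)
             (rightEndLikeᵇ-+-endLike H X (proviso-right (∧-conicalˡ _ _ endGX)) (∧-conicalʳ _ _ endGX))
      ... | inj₂ a with +ᴿ.Any⁻ G X a
      ...   | inj₁ viaG =
        All.lookupWith (λ {G'} m l → ≡true-stable (¬¬-map (rightAnswer G' x∈W l) m)) maintenance-right viaG
      ...   | inj₂ viaX =
        rightWinsFirst-move (H + X) (+ᴿ.Any⁺ʳ H X (any-apply (All.map ≽-leftLoses ihR) viaX))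

  test-sufficient : OptionClosed W → G ≥[ W ] H
  test-sufficient closed X x∈W = Equivalence.from ≥ₒ⇔≽ (option-induction step X x∈W)
    where
    step : ∀ X → All (λ X' → W X' → G + X' ≽ H + X') (leftOpts X) →
      All (λ X' → W X' → G + X' ≽ H + X') (rightOpts X) → W X → G + X ≽ H + X
    step X ihL ihR x∈W =
      let (wL , wR) = closed x∈W
      in ≽-step x∈W (All.zipWith (λ (f , w) → f w) (ihL , wL)) (All.zipWith (λ (f , w) → f w) (ihR , wR))

-- Necessity in a weak universe

Distinguishes : AForm → AForm → AForm → Set
Distinguishes G H X =
  LeftWinsFirst (H + X) × LeftLosesFirst (G + X) ⊎ RightWinsFirst (G + X) × RightLosesFirst (H + X)

distinguish : ∀ {A : GameSet} G H → ¬ G ≥[ A ] H → ¬ ¬ ∃ λ X → A X × Distinguishes G H X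
distinguish G H ¬ge none = ¬ge λ X x∈A → Equivalence.from (≥ₒ⇔≽ {G + X} {H + X}) record
  { leftFirst  = λ w → ≡true-stable λ l → none (X , x∈A , inj₁ (w , ¬-not l))
  ; rightFirst = λ w → ≡true-stable λ l → none (X , x∈A , inj₂ (w , ¬-not l))
  }

SomeSum : GameSet → (AForm → Set) → AForm → Set
SomeSum A P K = ∃ λ X → A X × P (K + X)

module Necessity {U : GameSet} (isU : Universe U) (weak : Weak U) where
  open Universe isU using (form)
  open RawMonad (¬¬-Monad {0ℓ}) using (_>>=_; return)

  -- {K |} is not Left end-like, so by weakness it is not Left U-strong.
  rightWinnable : ∀ K → ¬ ¬ SomeSum U RightWinsFirst K
  rightWinnable K none = [ (λ ()) , (λ ()) ]′ (Equivalence.to (proj₁ (weak K⁺)) strong)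
    where
    K⁺ : AForm
    K⁺ = node false false (K ∷ []) []
    strong : LeftStrong U K⁺
    strong X x∈U _ = oL≡𝓛 (K⁺ + X)
      (leftWinsFirst-move (K⁺ + X) (+ᴸ.Any⁺ˡ K⁺ X (here (¬-not λ w → none (X , x∈U , w)))))

  leftWinnable : ∀ K → ¬ ¬ SomeSum U LeftWinsFirst K
  leftWinnable K none = [ (λ ()) , (λ ()) ]′ (Equivalence.to (proj₂ (weak K⁺)) strong)
    where
    K⁺ : AForm
    K⁺ = node false false [] (K ∷ [])
    strong : RightStrong U K⁺
    strong X x∈U _ = oR≡𝓡 (K⁺ + X)
      (rightWinsFirst-move (K⁺ + X) (+ᴿ.Any⁺ˡ K⁺ X (here (¬-not λ w → none (X , x∈U , w)))))

  -- The Right option X of Y = {X | X, ts} is there only because `form` needs both option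
  -- lists non-empty.
  leftLosingPartner : ∀ A {X} → U X → RightWinsFirst (A + X) →
    All (SomeSum U LeftLosesFirst) (leftOpts A) →
    ∃ λ Y → U Y × X ∈ leftOpts Y × LeftLosesFirst (A + Y)
  leftLosingPartner A {X} x∈U w partners =
    let (ts , ts∈U , answers) = collectWitnesses partners
    in node false false (X ∷ []) (X ∷ ts) , form X [] X ts (x∈U ∷ []) (x∈U ∷ ts∈U) , here refl ,
       leftLosesFirst-+ A (w ∷ []) (All.map there answers)

  rightLosingPartner : ∀ B {X} → U X → LeftWinsFirst (B + X) →
    All (SomeSum U RightLosesFirst) (rightOpts B) →
    ∃ λ Y → U Y × X ∈ rightOpts Y × RightLosesFirst (B + Y)
  rightLosingPartner B {X} x∈U w partners =
    let (ts , ts∈U , answers) = collectWitnesses partners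
    in node false false (X ∷ ts) (X ∷ []) , form X ts X [] (x∈U ∷ ts∈U) (x∈U ∷ []) , here refl ,
       rightLosesFirst-+ B (w ∷ []) (All.map there answers)

  leftLosable : ∀ K → ¬ ¬ SomeSum U LeftLosesFirst K
  leftLosable = option-induction λ K partnersᴸ _ → do
    (X , x∈U , w) ← rightWinnable K
    partners ← sequence¬¬ partnersᴸ
    let (Y , y∈U , _ , l) = leftLosingPartner K x∈U w partners
    return (Y , y∈U , l)

  rightLosable : ∀ K → ¬ ¬ SomeSum U RightLosesFirst K
  rightLosable = option-induction λ K _ partnersᴿ → do
    (X , x∈U , w) ← leftWinnable K
    partners ← sequence¬¬ partnersᴿ
    let (Y , y∈U , _ , l) = rightLosingPartner K x∈U w partners
    return (Y , y∈U , l)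

  leftDistinguish : ∀ A B → ¬ A ≥[ U ] B →
    ¬ ¬ ∃ λ Y → (U Y × LeftWinsFirst (B + Y)) × LeftLosesFirst (A + Y)
  leftDistinguish A B ¬ge = do
    (X , x∈U , d) ← distinguish A B ¬ge
    partners ← sequence¬¬ (All.universal leftLosable (leftOpts A))
    return (byLeft x∈U d partners)
    where
    byLeft : ∀ {X} → U X → Distinguishes A B X → All (SomeSum U LeftLosesFirst) (leftOpts A) →
      ∃ λ Y → (U Y × LeftWinsFirst (B + Y)) × LeftLosesFirst (A + Y)
    byLeft x∈U (inj₁ (w , l)) _ = _ , (x∈U , w) , l
    byLeft x∈U (inj₂ (w , l)) partners =
      let (Y , y∈U , X∈ , lA) = leftLosingPartner A x∈U w partners
      in Y , (y∈U , leftWinsFirst-move (B + Y) (+ᴸ.Any⁺ʳ B Y (lose X∈ l))) , lA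

  rightDistinguish : ∀ A B → ¬ A ≥[ U ] B →
    ¬ ¬ ∃ λ Y → (U Y × RightWinsFirst (A + Y)) × RightLosesFirst (B + Y)
  rightDistinguish A B ¬ge = do
    (X , x∈U , d) ← distinguish A B ¬ge
    partners ← sequence¬¬ (All.universal rightLosable (rightOpts B))
    return (byRight x∈U d partners)
    where
    byRight : ∀ {X} → U X → Distinguishes A B X → All (SomeSum U RightLosesFirst) (rightOpts B) →
      ∃ λ Y → (U Y × RightWinsFirst (A + Y)) × RightLosesFirst (B + Y)
    byRight x∈U (inj₂ (w , l)) _ = _ , (x∈U , w) , l
    byRight x∈U (inj₁ (w , l)) partners =
      let (Y , y∈U , X∈ , lB) = rightLosingPartner B x∈U w partners
      in Y , (y∈U , rightWinsFirst-move (A + Y) (+ᴿ.Any⁺ʳ A Y (lose X∈ l))) , lB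

  -- In A + X Right answers a move to A' + X by A' + y, in B + X Left answers B' + X by B' + z.
  separating : ∀ A B →
    All (λ A' → ¬ A' ≥[ U ] B) (leftOpts A) → All (λ B' → ¬ A ≥[ U ] B') (rightOpts B) →
    ¬ ¬ ∃ λ X → U X × LeftLosesFirst (A + X) × RightLosesFirst (B + X)
  separating A B ¬A'≥B ¬A≥B' = do
    (xL , xL∈U , wL) ← rightWinnable A
    (xR , xR∈U , wR) ← leftWinnable B
    distinguishersᴸ ← sequence¬¬ (All.map (λ {A'} → leftDistinguish A' B) ¬A'≥B)
    distinguishersᴿ ← sequence¬¬ (All.map (λ {B'} → rightDistinguish A B') ¬A≥B')
    let (ys , ys∈ , answersᴸ) = collectWitnesses distinguishersᴸ
        (zs , zs∈ , answersᴿ) = collectWitnesses distinguishersᴿ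
    return ( node false false (xL ∷ zs) (xR ∷ ys)
           , form xL zs xR ys (xL∈U ∷ All.map proj₁ zs∈) (xR∈U ∷ All.map proj₁ ys∈)
           , leftLosesFirst-+ A (wL ∷ All.map proj₂ zs∈) (All.map there answersᴸ)
           , rightLosesFirst-+ B (wR ∷ All.map proj₂ ys∈) (All.map there answersᴿ) )

  ≥-proviso-left : ∀ G H → G ≥[ U ] H → leftEndLikeᵇ H ≡ true → leftEndLikeᵇ G ≡ true
  ≥-proviso-left G H ge endH = leftEndLike⇒ᵇ G (Equivalence.to (proj₁ (weak G)) strong)
    where
    strong : LeftStrong U G
    strong X x∈U endX = oL≡𝓛 (G + X) (leftFirst (≥-≽ G H ge x∈U)
      (leftWinsFirst-endLike (H + X) (leftEndLikeᵇ-+-endLike H X endH (leftEndLike⇒ᵇ X (inj₂ endX)))))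

  ≥-proviso-right : ∀ G H → G ≥[ U ] H → rightEndLikeᵇ G ≡ true → rightEndLikeᵇ H ≡ true
  ≥-proviso-right G H ge endG = rightEndLike⇒ᵇ H (Equivalence.to (proj₂ (weak H)) strong)
    where
    strong : RightStrong U H
    strong X x∈U endX = oR≡𝓡 (H + X) (rightFirst (≥-≽ G H ge x∈U)
      (rightWinsFirst-endLike (G + X) (rightEndLikeᵇ-+-endLike G X endG (rightEndLike⇒ᵇ X (inj₂ endX)))))

  ≥-maintenance-left : ∀ G H → G ≥[ U ] H →
    All (λ H' → ¬ ¬ LeftMaintenance _≥[ U ]_ G H') (leftOpts H)
  ≥-maintenance-left G H ge = All.tabulate λ {H'} H'∈ ¬m →
    separating G H' (¬Any⇒All¬ _ (¬m ∘ inj₁)) (¬Any⇒All¬ _ (¬m ∘ inj₂)) λ (X , x∈U , lG , rH') →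
      not-¬ (leftFirst (≥-≽ G H ge x∈U) (leftWinsFirst-move (H + X) (+ᴸ.Any⁺ˡ H X (lose H'∈ rH')))) lG

  ≥-maintenance-right : ∀ G H → G ≥[ U ] H →
    All (λ G' → ¬ ¬ RightMaintenance _≥[ U ]_ G' H) (rightOpts G)
  ≥-maintenance-right G H ge = All.tabulate λ {G'} G'∈ ¬m →
    separating G' H (¬Any⇒All¬ _ (¬m ∘ inj₂)) (¬Any⇒All¬ _ (¬m ∘ inj₁)) λ (X , x∈U , lG' , rH) →
      not-¬ (rightFirst (≥-≽ G H ge x∈U) (rightWinsFirst-move (G + X) (+ᴿ.Any⁺ˡ G X (lose G'∈ lG')))) rH

  test-necessary : ∀ G H → G ≥[ U ] H → ComparisonTest _≥[ U ]_ G H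
  test-necessary G H ge = record
    { proviso-left      = ≥-proviso-left G H ge
    ; proviso-right     = ≥-proviso-right G H ge
    ; maintenance-left  = ≥-maintenance-left G H ge
    ; maintenance-right = ≥-maintenance-right G H ge
    }

≥-weak⇒≥-closed : ∀ {U W} → Universe U → Weak U → OptionClosed W →
  ∀ G H → G ≥[ U ] H → G ≥[ W ] H
≥-weak⇒≥-closed {U} {W} isU weak closed = size-induction {P = λ G H → G ≥[ U ] H → G ≥[ W ] H}
  λ {G} {H} smaller ge →
    test-sufficient (test-map smaller (Necessity.test-necessary isU weak G H ge)) closed

proposition5p3 : (U W : GameSet) → Universe U → Universe W → Weak U → Weak W →
    (G H : AForm) → (G ≥[ U ] H) ⇔ (G ≥[ W ] H)
proposition5p3 U W isU isW weakU weakW G H =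
  mk⇔ (≥-weak⇒≥-closed isU weakU (universe-optionClosed isW) G H)
      (≥-weak⇒≥-closed isW weakW (universe-optionClosed isU) G H)
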